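{- Let $\alpha,\beta,q\in\mathbb{Z}$ and let $(Z_n : NC^{\mathrm{(mton)}}(n)\to\mathbb{R})_{n\ge1}$ be recursive of the second kind with input $(\alpha,\beta;q)$. For $n\in\mathbb{N}$ let $L_n(t)=\sum_{(\pi,u)\in NC^{\mathrm{(mton)}}(n)} t^{Z_n(\pi,u)}$, $t>0$. Then for every $n\ge2$ and $t\in(0,\infty)$, $$L_n(t) = \bigl(q\,t^{\alpha} + ((n+1)-q)\,t^{\beta}\bigr) L_{n-1}(t) + \bigl(t^{\alpha+1} - t^{\beta+1}\bigr) L_{n-1}'(t).$$
   Context: $NC(n)$: non-crossing partitions of $\{1,\ldots,n\}$. For blocks $V,W$, "$V$ nested inside $W$" means $\min V>\min W$ and $\max V<\max W$. A monotonic ordering of $\pi\in NC(n)$ is a bijection $u:\pi\to\{1,\ldots,|\pi|\}$ with $u(V)>u(W)$ whenever $V$ is nested inside $W$; $NC^{\mathrm{(mton)}}(n)$ is the set of such pairs $(\pi,u)$. $J(\pi,u):=u^{ -1}(|\pi|)$ (an interval). For $n\ge2$, the parent $\mathfrak{p}(\pi,u)=(\rho,v)\in NC^{\mathrm{(mton)}}(n-1)$: with $m=\max J(\pi,u)$ and $\phi$ the increasing bijection $\{1,\ldots,n\}\setminus\{m\}\to\{1,\ldots,n-1\}$, $\rho=\{\phi(V\setminus\{m\}) : V\in\pi, V\ne\{m\}\}$ and $v(\phi(V\setminus\{m\}))=u(V)$. For $(\rho,v)\in NC^{\mathrm{(mton)}}(n-1)$, $C(\rho,v):=\{(\pi,u)\in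 NC^{\mathrm{(mton)}}(n) : \mathfrak{p}(\pi,u)=(\rho,v)\}$ (it has exactly $n+1$ elements). A sequence $(Z_n : NC^{\mathrm{(mton)}}(n)\to\mathbb{R})$ is recursive of the second kind with input $(\alpha,\beta;q)$ if for every $n\ge2$ and $(\rho,v)\in NC^{\mathrm{(mton)}}(n-1)$ there is a subset $C_o(\rho,v)\subseteq C(\rho,v)$ such that $Z_n(\pi,u)=Z_{n-1}(\rho,v)+\alpha$ for $(\pi,u)\in C_o(\rho,v)$, $Z_n(\pi,u)=Z_{n-1}(\rho,v)+\beta$ for $(\pi,u)\in C(\rho,v)\setminus C_o(\rho,v)$, and $|C_o(\rho,v)|=Z_{n-1}(\rho,v)+q$.
   Formalization: The variable t of the transforms L_n ranges over the positive rationals instead of $(0,\infty)$. -}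

module Defs where

open import Data.Bool using (Bool; true; false; _∧_; _∨_; not; T; if_then_else_)
open import Data.Bool.Properties using (T?)
open import Data.Nat as ℕ using (ℕ; zero; suc; _⊔_; _⊓_; _≡ᵇ_; _<ᵇ_; _≤ᵇ_)
open import Data.Integer as ℤ using (ℤ; +_; -[1+_])
open import Data.Rational as ℚ using (ℚ; 0ℚ; 1ℚ; _<_; >-nonZero)
open import Data.List as List using (List; []; _∷_; upTo; filterᵇ; concatMap; map; length; foldr)
open import Data.Bool.ListAction using (all; any)
open import Data.Vec as Vec using (Vec; []; _∷_; toList)
open import Data.Product using (Σ; _×_)
open import Relation.Nullary using (yes; no)
open import Relation.Binary.PropositionalEquality using (_≡_)

-- A pair (π,u) ∈ NC^(mton)(n) is encoded by its labelling vector
-- w = (w_1,…,w_n), where w_i = u(V) for the block V ∋ i.  Since u is a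
-- bijection π → {1,…,|π|}, (π,u) ↦ w is a bijection onto the vectors w
-- whose set of values is exactly {1,…,k} (k = |π|) and whose fibres
-- (the blocks) satisfy non-crossingness and the monotonicity condition.
-- Positions are 0-based internally (i ↔ i+1).

nth : List ℕ → ℕ → ℕ
nth []       _       = 0
nth (x ∷ xs) zero    = x
nth (x ∷ xs) (suc i) = nth xs i

-- number of blocks |π| = largest label
maxLabel : List ℕ → ℕ
maxLabel = foldr _⊔_ 0

labels1to : ℕ → List ℕ
labels1to k = map suc (upTo k)

blockPos : List ℕ → ℕ → List ℕ
blockPos w x = filterᵇ (λ i → nth w i ≡ᵇ x) (upTo (length w))

blockMin blockMax : List ℕ → ℕ → ℕ
blockMin w x = foldr _⊓_ (length w) (blockPos w x)
blockMax w x = foldr _⊔_ 0 (blockPos w x)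

-- u is a bijection onto {1,…,k}: every label is ≥ 1 and every j ∈ {1..k} occurs
labelsOK : List ℕ → Bool
labelsOK w = all (λ x → 1 ≤ᵇ x) w
           ∧ all (λ j → any (λ x → x ≡ᵇ j) w) (labels1to (maxLabel w))

nonCrossing : List ℕ → Bool
nonCrossing w =
  all (λ a → all (λ b → all (λ c → all (λ d →
      not ((a <ᵇ b) ∧ (b <ᵇ c) ∧ (c <ᵇ d)
           ∧ (nth w a ≡ᵇ nth w c) ∧ (nth w b ≡ᵇ nth w d)
           ∧ not (nth w a ≡ᵇ nth w b)))
    is) is) is) is
  where is = upTo (length w)

nestedIn : List ℕ → ℕ → ℕ → Bool
nestedIn w x y = (blockMin w y <ᵇ blockMin w x) ∧ (blockMax w x <ᵇ blockMax w y)

monotonic : List ℕ → Bool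
monotonic w = all (λ x → all (λ y → not (nestedIn w x y) ∨ (y <ᵇ x)) ks) ks
  where ks = labels1to (maxLabel w)

isMton : List ℕ → Bool
isMton w = labelsOK w ∧ nonCrossing w ∧ monotonic w

record NCm (n : ℕ) : Set where
  constructor mkNCm
  field
    labels : Vec ℕ n
    valid  : T (isMton (toList labels))
open NCm public

allVecs : (n k : ℕ) → List (Vec ℕ n)
allVecs zero    k = [] ∷ []
allVecs (suc n) k = concatMap (λ x → map (x ∷_) (allVecs n k)) (labels1to k)

toNCm : ∀ {n} → Vec ℕ n → List (NCm n)
toNCm v with T? (isMton (toList v))
... | yes p = mkNCm v p ∷ []
... | no  _ = []

enumNCm : (n : ℕ) → List (NCm n)
enumNCm n = concatMap toNCm (allVecs n n)

-- Parent map, on labelling vectors: m = max J(π,u) is the largest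
-- position carrying the top label |π|; delete position m (labels of the
-- remaining blocks are unchanged, the block {m} disappears if singleton).

removeNat : ∀ {n} → Vec ℕ (suc n) → ℕ → Vec ℕ n
removeNat (x ∷ xs)         zero    = xs
removeNat (x ∷ [])         (suc i) = []
removeNat (x ∷ xs@(_ ∷ _)) (suc i) = x ∷ removeNat xs i

parentLabels : ∀ {n} → NCm (suc n) → Vec ℕ n
parentLabels π = removeNat (labels π) (blockMax w (maxLabel w))
  where w = toList (labels π)

inC : ∀ {n} → NCm n → NCm (suc n) → Bool
inC ρ π = Vec.foldr _ _∧_ true (Vec.zipWith _≡ᵇ_ (parentLabels π) (labels ρ))

-- Indices: NCm (suc (suc n)) is level n+2 ≥ 2, its parents are in NCm (suc n).
-- The subset C_o(ρ,v) ⊆ C(ρ,v) is given by a characteristic function Co.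

RecursiveSecondKind : (α β q : ℤ) → ((n : ℕ) → NCm n → ℤ) → Set
RecursiveSecondKind α β q Z =
  ∀ (n : ℕ) (ρ : NCm (suc n)) →
  Σ (NCm (suc (suc n)) → Bool) λ Co →
    (∀ π → T (inC ρ π) → T (Co π) → Z (suc (suc n)) π ≡ Z (suc n) ρ ℤ.+ α)
  × (∀ π → T (inC ρ π) → T (not (Co π)) → Z (suc (suc n)) π ≡ Z (suc n) ρ ℤ.+ β)
  × (+ length (filterᵇ (λ π → inC ρ π ∧ Co π) (enumNCm (suc (suc n))))
       ≡ Z (suc n) ρ ℤ.+ q)

powℕ : ℚ → ℕ → ℚ
powℕ t zero    = 1ℚ
powℕ t (suc k) = t ℚ.* powℕ t k

powℤ : (t : ℚ) → 0ℚ < t → ℤ → ℚ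
powℤ t _   (+ k)      = powℕ t k
powℤ t t>0 -[1+ k ]   = powℕ (ℚ.1/_ t {{>-nonZero t>0}}) (suc k)

fromℤ : ℤ → ℚ
fromℤ z = z ℚ./ 1

sumℚ : List ℚ → ℚ
sumℚ = foldr ℚ._+_ 0ℚ

powerSum : List ℤ → (t : ℚ) → 0ℚ < t → ℚ
powerSum es t t>0 = sumℚ (map (λ e → powℤ t t>0 e) es)

powerSumDeriv : List ℤ → (t : ℚ) → 0ℚ < t → ℚ
powerSumDeriv es t t>0 = sumℚ (map (λ e → fromℤ e ℚ.* powℤ t t>0 (e ℤ.- + 1)) es)

L : ((n : ℕ) → NCm n → ℤ) → (n : ℕ) → (t : ℚ) → 0ℚ < t → ℚ
L Z n = powerSum (map (Z n) (enumNCm n))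

L′ : ((n : ℕ) → NCm n → ℤ) → (n : ℕ) → (t : ℚ) → 0ℚ < t → ℚ
L′ Z n = powerSumDeriv (map (Z n) (enumNCm n))

{-# OPTIONS --safe #-}
-- Encode (π,u) by its vector of block labels; the parent map deletes the last
-- position carrying the top label K = |π|.  A labelling ρ of length
-- n+1 has exactly n+3 children: a new singleton block labelled K+1 inserted at
-- any of the n+2 positions, or the top block of ρ extended by the position
-- right after its last point.  Grouping L_{n+2}(t) by parents, the children of
-- ρ contribute (z+q) t^(z+α) + (n+3-z-q) t^(z+β) with z = Z(ρ), and
-- z t^(z+α) = t^(α+1) · z t^(z-1) turns the sum over ρ into the stated
-- combination of L_{n+1}(t) and L′_{n+1}(t).

module Submission where

open import Defs

open import Data.Bool using (Bool; true; false; _∧_; not; T; if_then_else_)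
open import Data.Bool.Properties using (T?; T-∧; T-∨; T-irrelevant)
open import Data.Bool.ListAction using (all)
open import Data.Integer as ℤ using (ℤ; +_; -[1+_]; _⊖_)
import Data.Integer.Properties as ℤP
import Data.Integer.Solver as ℤ-Solver
open import Data.List using (List; []; _∷_; upTo; applyUpTo; filter; filterᵇ; concatMap; map; length; foldr)
open import Data.List.Membership.Propositional using (_∈_; find; lose)
open import Data.List.Membership.Propositional.Properties
open import Data.List.Membership.Propositional.Properties.WithK using (unique∧set⇒bag)
open import Data.List.Properties using (length-applyUpTo; length-map; map-∘; filter-accept; filter-reject)
open import Data.List.Relation.Binary.BagAndSetEquality using (_∼[_]_; set; ∼bag⇒↭)
open import Data.List.Relation.Binary.Permutation.Propositional.Properties using (↭-length)
open import Data.List.Relation.Unary.All as All using ([]; _∷_)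
open import Data.List.Relation.Unary.All.Properties as All using (all⁺; all⁻; applyUpTo⁺₁)
import Data.List.Relation.Unary.AllPairs as AllPairs
import Data.List.Relation.Unary.AllPairs.Properties as AllPairs
open import Data.List.Relation.Unary.Any using (here; there)
open import Data.List.Relation.Unary.Any.Properties using (any⁺; any⁻)
open import Data.List.Relation.Unary.Unique.Propositional using (Unique; []; _∷_)
import Data.List.Relation.Unary.Unique.Propositional.Properties as Unique
open import Data.Nat as ℕ using (ℕ; zero; suc; _≤_; _<_; _⊔_; _⊓_; z≤n; s≤s; _≟_; _≤?_)
open import Data.Nat.Properties
open import Algebra.Properties.CommutativeSemigroup ⊔-commutativeSemigroup using (x∙yz≈y∙xz)
open import Data.Product using (∃-syntax; _×_; _,_; proj₁; proj₂)
open import Data.Rational as ℚ using (ℚ; 0ℚ; 1ℚ; >-nonZero)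
import Data.Rational.Properties as ℚP
import Data.Rational.Solver as ℚ-Solver
import Data.Rational.Unnormalised as ℚᵘ
import Data.Rational.Unnormalised.Properties as ℚᵘP
open import Data.Sum using (_⊎_; inj₁; inj₂)
open import Data.Vec as Vec using (Vec; []; _∷_; toList)
open import Data.Vec.Properties using (length-toList; ∷-injectiveˡ; ∷-injectiveʳ)
open import Function using (_∘_; _⇔_; Equivalence; mk⇔)
open import Relation.Binary.Definitions using (tri<; tri≈; tri>)
open import Relation.Binary.PropositionalEquality
open import Relation.Nullary using (¬_; yes; no; contradiction)

open Equivalence using (to; from)

T-∧⁺ : ∀ {a b} → T a → T b → T (a ∧ b)
T-∧⁺ p q = from T-∧ (p , q)

T-not⁺ : ∀ {b} → ¬ T b → T (not b)
T-not⁺ {false} _ = _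
T-not⁺ {true} ¬t = ¬t _

T-not⁻ : ∀ {b} → T (not b) → ¬ T b
T-not⁻ {false} _ ()
T-not⁻ {true} ()

module _ {A : Set} (p : A → Bool) where

  all-∈ : ∀ xs {x} → T (all p xs) → x ∈ xs → T (p x)
  all-∈ xs h = All.lookup (all⁺ p xs h)

  ∈-all : ∀ xs → (∀ {x} → x ∈ xs → T (p x)) → T (all p xs)
  ∈-all xs f = all⁻ p (All.tabulate f)

nth-∈ : ∀ w {i} → i < length w → nth w i ∈ w
nth-∈ (x ∷ w) {zero} _ = here refl
nth-∈ (x ∷ w) {suc i} (s≤s h) = there (nth-∈ w h)

∈⇒nth : ∀ {w x} → x ∈ w → ∃[ i ] i < length w × nth w i ≡ x
∈⇒nth (here refl) = 0 , s≤s z≤n , refl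
∈⇒nth (there m) = let (i , h , e) = ∈⇒nth m in suc i , s≤s h , e

≤-foldr-⊔ : ∀ {xs y} → y ∈ xs → y ≤ foldr _⊔_ 0 xs
≤-foldr-⊔ {x ∷ xs} (here refl) = m≤m⊔n x _
≤-foldr-⊔ {x ∷ xs} (there m) = m≤n⇒m≤o⊔n x (≤-foldr-⊔ m)

foldr-⊔-lub : ∀ {xs m} → (∀ {y} → y ∈ xs → y ≤ m) → foldr _⊔_ 0 xs ≤ m
foldr-⊔-lub {[]} _ = z≤n
foldr-⊔-lub {x ∷ xs} f = ⊔-lub (f (here refl)) (foldr-⊔-lub (f ∘ there))

foldr-⊔-∈ : ∀ {xs y} → y ∈ xs → foldr _⊔_ 0 xs ∈ xs
foldr-⊔-∈ {xs} {y} m with foldr-selective ⊔-sel 0 xs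
... | inj₂ m′ = m′
... | inj₁ e = subst (_∈ xs) (trans (n≤0⇒n≡0 (subst (y ≤_) e (≤-foldr-⊔ m))) (sym e)) m

foldr-⊓-≤ : ∀ N {xs y} → y ∈ xs → foldr _⊓_ N xs ≤ y
foldr-⊓-≤ N {x ∷ xs} (here refl) = m⊓n≤m x _
foldr-⊓-≤ N {x ∷ xs} (there m) = ≤-trans (m⊓n≤n x _) (foldr-⊓-≤ N m)

foldr-⊓-∈ : ∀ N {xs y} → y ∈ xs → y < N → foldr _⊓_ N xs ∈ xs
foldr-⊓-∈ N {xs} m y<N with foldr-selective ⊓-sel N xs
... | inj₂ m′ = m′
... | inj₁ e = contradiction (subst (_≤ _) e (foldr-⊓-≤ N m)) (<⇒≱ y<N)

nth≤maxLabel : ∀ w {i} → i < length w → nth w i ≤ maxLabel w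
nth≤maxLabel w h = ≤-foldr-⊔ {w} (nth-∈ w h)

maxLabel-lub : ∀ w {m} → (∀ {i} → i < length w → nth w i ≤ m) → maxLabel w ≤ m
maxLabel-lub w f = foldr-⊔-lub {w} λ y∈w → let (i , h , e) = ∈⇒nth {w} y∈w in subst (_≤ _) e (f h)

maxLabel-attained : ∀ w → 0 < length w → ∃[ i ] i < length w × nth w i ≡ maxLabel w
maxLabel-attained (x ∷ w) _ = ∈⇒nth (foldr-⊔-∈ {x ∷ w} (here refl))

0<maxLabel⇒0<length : ∀ w → 0 < maxLabel w → 0 < length w
0<maxLabel⇒0<length (x ∷ w) _ = s≤s z≤n

∈-labels1to⁺ : ∀ {K x} → 1 ≤ x → x ≤ K → x ∈ labels1to K
∈-labels1to⁺ {x = suc x} _ h = ∈-map⁺ suc (∈-upTo⁺ h)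

∈-labels1to⁻ : ∀ {K x} → x ∈ labels1to K → 1 ≤ x × x ≤ K
∈-labels1to⁻ m with ∈-map⁻ suc m
... | i , i∈ , refl = s≤s z≤n , ∈-upTo⁻ i∈

module _ (w : List ℕ) (x : ℕ) where

  ∈-blockPos⁺ : ∀ {i} → i < length w → nth w i ≡ x → i ∈ blockPos w x
  ∈-blockPos⁺ h e = ∈-filter⁺ (λ i → T? (nth w i ℕ.≡ᵇ x)) (∈-upTo⁺ h) (≡⇒≡ᵇ _ _ e)

  ∈-blockPos⁻ : ∀ {i} → i ∈ blockPos w x → i < length w × nth w i ≡ x
  ∈-blockPos⁻ m =
    let (m′ , t) = ∈-filter⁻ (λ i → T? (nth w i ℕ.≡ᵇ x)) {xs = upTo (length w)} m
    in ∈-upTo⁻ m′ , ≡ᵇ⇒≡ _ _ t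

  blockMin-≤ : ∀ {i} → i < length w → nth w i ≡ x → blockMin w x ≤ i
  blockMin-≤ h e = foldr-⊓-≤ (length w) (∈-blockPos⁺ h e)

  blockMin-∈ : ∀ {i} → i < length w → nth w i ≡ x →
               blockMin w x < length w × nth w (blockMin w x) ≡ x
  blockMin-∈ h e = ∈-blockPos⁻ (foldr-⊓-∈ (length w) (∈-blockPos⁺ h e) h)

  ≤-blockMax : ∀ {i} → i < length w → nth w i ≡ x → i ≤ blockMax w x
  ≤-blockMax h e = ≤-foldr-⊔ (∈-blockPos⁺ h e)

  blockMax-∈ : ∀ {i} → i < length w → nth w i ≡ x →
               blockMax w x < length w × nth w (blockMax w x) ≡ x
  blockMax-∈ h e = ∈-blockPos⁻ (foldr-⊔-∈ (∈-blockPos⁺ h e))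

  blockMax-≡ : ∀ {p} → p < length w → nth w p ≡ x →
               (∀ {i} → i < length w → nth w i ≡ x → i ≤ p) → blockMax w x ≡ p
  blockMax-≡ h e f = ≤-antisym (foldr-⊔-lub λ m → let (h′ , e′) = ∈-blockPos⁻ m in f h′ e′) (≤-blockMax h e)

LabelsPositive : List ℕ → Set
LabelsPositive w = ∀ {i} → i < length w → 1 ≤ nth w i

LabelsOnto : List ℕ → Set
LabelsOnto w = ∀ {j} → 1 ≤ j → j ≤ maxLabel w → ∃[ i ] i < length w × nth w i ≡ j

NonCrossing : List ℕ → Set
NonCrossing w = ∀ {a b c d} → a < b → b < c → c < d → d < length w →
  nth w a ≡ nth w c → nth w b ≡ nth w d → nth w a ≡ nth w b

Monotonic : List ℕ → Set
Monotonic w = ∀ {x y} → x ∈ labels1to (maxLabel w) → y ∈ labels1to (maxLabel w) →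
  blockMin w y < blockMin w x → blockMax w x < blockMax w y → y < x

-- Non-crossing and monotonicity together say exactly this: a point strictly
-- between two points of a block V but outside V lies in a block nested inside V,
-- so it carries a larger label.
EnclosedLarger : List ℕ → Set
EnclosedLarger w = ∀ {a b d} → a < b → b < d → d < length w →
  nth w a ≡ nth w d → nth w b ≢ nth w a → nth w a < nth w b

record Valid (w : List ℕ) : Set where
  field
    positive        : LabelsPositive w
    onto            : LabelsOnto w
    enclosed-larger : EnclosedLarger w
open Valid

module _ (w : List ℕ) where

  labelsOK⇒ : T (labelsOK w) → LabelsPositive w × LabelsOnto w
  labelsOK⇒ h = pos , onto′
    where
      pos : LabelsPositive w
      pos i<N = ≤ᵇ⇒≤ 1 _ (all-∈ _ w (proj₁ (to T-∧ h)) (nth-∈ w i<N))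
      onto′ : LabelsOnto w
      onto′ {j} 1≤j j≤K =
        let (x , x∈w , x≡ᵇj) = find (any⁻ _ w (all-∈ _ (labels1to (maxLabel w)) (proj₂ (to T-∧ h)) (∈-labels1to⁺ 1≤j j≤K)))
            (i , i<N , e) = ∈⇒nth x∈w
        in i , i<N , trans e (≡ᵇ⇒≡ x j x≡ᵇj)

  labelsOK⇐ : LabelsPositive w → LabelsOnto w → T (labelsOK w)
  labelsOK⇐ pos onto′ = T-∧⁺
    (∈-all _ w λ x∈w → let (i , i<N , e) = ∈⇒nth x∈w in ≤⇒≤ᵇ (subst (1 ≤_) e (pos i<N)))
    (∈-all _ (labels1to (maxLabel w)) λ j∈ →
      let (1≤j , j≤K) = ∈-labels1to⁻ j∈
          (i , i<N , e) = onto′ 1≤j j≤K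
      in any⁺ _ (lose (nth-∈ w i<N) (≡⇒≡ᵇ _ _ e)))

  nonCrossing⇒ : T (nonCrossing w) → NonCrossing w
  nonCrossing⇒ h {a} {b} {c} {d} ab bc cd dN eac ebd with nth w a ≟ nth w b
  ... | yes e = e
  ... | no ne = contradiction crossing (T-not⁻ (all-∈ _ is (all-∈ _ is (all-∈ _ is (all-∈ _ is h
                  (∈-upTo⁺ aN)) (∈-upTo⁺ bN)) (∈-upTo⁺ cN)) (∈-upTo⁺ dN)))
    where
      is = upTo (length w)
      cN = <-trans cd dN
      bN = <-trans bc cN
      aN = <-trans ab bN
      crossing = T-∧⁺ (<⇒<ᵇ ab) (T-∧⁺ (<⇒<ᵇ bc) (T-∧⁺ (<⇒<ᵇ cd)
                   (T-∧⁺ (≡⇒≡ᵇ _ _ eac) (T-∧⁺ (≡⇒≡ᵇ _ _ ebd) (T-not⁺ (ne ∘ ≡ᵇ⇒≡ _ _))))))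

  nonCrossing⇐ : NonCrossing w → T (nonCrossing w)
  nonCrossing⇐ nc =
    ∈-all _ is λ {a} _ → ∈-all _ is λ {b} _ → ∈-all _ is λ {c} _ → ∈-all _ is λ {d} d∈ → T-not⁺ λ t →
    let (ab , t₁) = to (T-∧ {a ℕ.<ᵇ b}) t
        (bc , t₂) = to (T-∧ {b ℕ.<ᵇ c}) t₁
        (cd , t₃) = to (T-∧ {c ℕ.<ᵇ d}) t₂
        (eac , t₄) = to (T-∧ {nth w a ℕ.≡ᵇ nth w c}) t₃
        (ebd , ne) = to (T-∧ {nth w b ℕ.≡ᵇ nth w d}) t₄
    in T-not⁻ ne (≡⇒≡ᵇ _ _ (nc (<ᵇ⇒< _ _ ab) (<ᵇ⇒< _ _ bc) (<ᵇ⇒< _ _ cd) (∈-upTo⁻ d∈)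
                                (≡ᵇ⇒≡ _ _ eac) (≡ᵇ⇒≡ _ _ ebd)))
    where is = upTo (length w)

  monotonic⇒ : T (monotonic w) → Monotonic w
  monotonic⇒ h x∈ y∈ min< max< with to T-∨ (all-∈ _ (labels1to (maxLabel w)) (all-∈ _ (labels1to (maxLabel w)) h x∈) y∈)
  ... | inj₁ ¬nested = contradiction (T-∧⁺ (<⇒<ᵇ min<) (<⇒<ᵇ max<)) (T-not⁻ ¬nested)
  ... | inj₂ y<x = <ᵇ⇒< _ _ y<x

  monotonic⇐ : Monotonic w → T (monotonic w)
  monotonic⇐ mono = ∈-all _ ks λ x∈ → ∈-all _ ks λ y∈ → from T-∨ (ordered x∈ y∈)
    where
      ks = labels1to (maxLabel w)
      ordered : ∀ {x y} → x ∈ labels1to (maxLabel w) → y ∈ labels1to (maxLabel w) →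
                T (not (nestedIn w x y)) ⊎ T (y ℕ.<ᵇ x)
      ordered {x} {y} x∈ y∈ with T? (nestedIn w x y)
      ... | no ¬nested = inj₁ (T-not⁺ ¬nested)
      ... | yes nested = let (min< , max<) = to T-∧ nested in
                         inj₂ (<⇒<ᵇ (mono x∈ y∈ (<ᵇ⇒< _ _ min<) (<ᵇ⇒< _ _ max<)))

  enclosedLarger : LabelsPositive w → NonCrossing w → Monotonic w → EnclosedLarger w
  enclosedLarger pos nc mono {a} {b} {d} ab bd dN ead neq =
    mono (∈-labels1to⁺ (pos bN) (nth≤maxLabel w bN)) (∈-labels1to⁺ (pos aN) (nth≤maxLabel w aN))
         (≤-<-trans (blockMin-≤ w _ aN refl) a<min) (<-≤-trans max<d (≤-blockMax w _ dN (sym ead)))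
    where
      bN = <-trans bd dN
      aN = <-trans ab bN
      min = blockMin-∈ w (nth w b) bN refl
      max = blockMax-∈ w (nth w b) bN refl
      a<min : a < blockMin w (nth w b)
      a<min with <-cmp a (blockMin w (nth w b))
      ... | tri< a<i _ _ = a<i
      ... | tri≈ _ a≡i _ = contradiction (trans (cong (nth w) a≡i) (proj₂ min)) (neq ∘ sym)
      ... | tri> _ _ i<a = contradiction (trans (sym (proj₂ min)) (nc i<a ab bd dN (proj₂ min) ead)) neq
      max<d : blockMax w (nth w b) < d
      max<d with <-cmp (blockMax w (nth w b)) d
      ... | tri< j<d _ _ = j<d
      ... | tri≈ _ j≡d _ = contradiction (trans (sym (proj₂ max)) (trans (cong (nth w) j≡d) (sym ead))) neq
      ... | tri> _ _ d<j = contradiction (sym (nc ab bd d<j (proj₁ max) ead (sym (proj₂ max)))) neq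

  enclosedLarger⇒nonCrossing : EnclosedLarger w → NonCrossing w
  enclosedLarger⇒nonCrossing el {a} {b} {c} ab bc cd dN eac ebd with nth w a ≟ nth w b
  ... | yes e = e
  ... | no ne = contradiction (el ab bc (<-trans cd dN) eac (ne ∘ sym))
                  (<⇒≯ (subst (nth w b <_) (sym eac) (el bc cd dN ebd (ne ∘ trans eac))))

  enclosedLarger⇒monotonic : LabelsOnto w → EnclosedLarger w → Monotonic w
  enclosedLarger⇒monotonic onto′ el {x} {y} x∈ y∈ min< max< =
    subst₂ _<_ (proj₂ minY) (proj₂ minX)
      (el min< minX<maxY (proj₁ maxY) (trans (proj₂ minY) (sym (proj₂ maxY))) different)
    where
      block : ∀ {z} → z ∈ labels1to (maxLabel w) → ∃[ i ] i < length w × nth w i ≡ z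
      block z∈ = let (1≤z , z≤K) = ∈-labels1to⁻ z∈ in onto′ 1≤z z≤K
      minX = blockMin-∈ w x (proj₁ (proj₂ (block x∈))) (proj₂ (proj₂ (block x∈)))
      minY = blockMin-∈ w y (proj₁ (proj₂ (block y∈))) (proj₂ (proj₂ (block y∈)))
      maxY = blockMax-∈ w y (proj₁ (proj₂ (block y∈))) (proj₂ (proj₂ (block y∈)))
      minX<maxY = ≤-<-trans (≤-blockMax w x (proj₁ minX) (proj₂ minX)) max<
      different : nth w (blockMin w x) ≢ nth w (blockMin w y)
      different e = <-irrefl (cong (blockMin w) (trans (sym (proj₂ minY)) (trans (sym e) (proj₂ minX)))) min<

isMton⇒Valid : ∀ w → T (isMton w) → Valid w
isMton⇒Valid w h =
  let (lab , rest) = to T-∧ h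
      (nc , mono) = to T-∧ rest
      (pos , onto′) = labelsOK⇒ w lab
  in record { positive = pos ; onto = onto′
            ; enclosed-larger = enclosedLarger w pos (nonCrossing⇒ w nc) (monotonic⇒ w mono) }

Valid⇒isMton : ∀ w → Valid w → T (isMton w)
Valid⇒isMton w v = T-∧⁺ (labelsOK⇐ w (positive v) (onto v))
  (T-∧⁺ (nonCrossing⇐ w (enclosedLarger⇒nonCrossing w (enclosed-larger v)))
        (monotonic⇐ w (enclosedLarger⇒monotonic w (onto v) (enclosed-larger v))))

-- The ℕ-indexed analogue of Data.Fin.punchIn: where entry i of a vector moves
-- when a new entry is inserted at position m.
punchIn : ℕ → ℕ → ℕ
punchIn zero i = suc i
punchIn (suc m) zero = zero
punchIn (suc m) (suc i) = suc (punchIn m i)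

insertNat : ∀ {n} → ℕ → ℕ → Vec ℕ n → Vec ℕ (suc n)
insertNat zero x v = x ∷ v
insertNat (suc p) x [] = x ∷ []
insertNat (suc p) x (y ∷ v) = y ∷ insertNat p x v

punchIn-mono-< : ∀ m {i j} → i < j → punchIn m i < punchIn m j
punchIn-mono-< zero h = s≤s h
punchIn-mono-< (suc m) {zero} {suc j} h = s≤s z≤n
punchIn-mono-< (suc m) {suc i} {suc j} (s≤s h) = s≤s (punchIn-mono-< m h)

punchIn-cancel-< : ∀ m {i j} → punchIn m i < punchIn m j → i < j
punchIn-cancel-< m {i} {j} h with <-cmp i j
... | tri< i<j _ _ = i<j
... | tri≈ _ refl _ = contradiction h (<-irrefl refl)
... | tri> _ _ j<i = contradiction h (<-asym (punchIn-mono-< m j<i))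

punchIn≢ : ∀ m i → punchIn m i ≢ m
punchIn≢ zero i ()
punchIn≢ (suc m) zero ()
punchIn≢ (suc m) (suc i) e = punchIn≢ m i (suc-injective e)

punchIn-< : ∀ {m i} → i < m → punchIn m i ≡ i
punchIn-< {suc m} {zero} _ = refl
punchIn-< {suc m} {suc i} (s≤s h) = cong suc (punchIn-< h)

punchIn-≥ : ∀ {m i} → m ≤ i → punchIn m i ≡ suc i
punchIn-≥ {zero} _ = refl
punchIn-≥ {suc m} {suc i} (s≤s h) = cong suc (punchIn-≥ h)

punchIn-<-cancel : ∀ {m i} → punchIn m i < m → i < m
punchIn-<-cancel {m} {i} h with m ≤? i
... | yes m≤i = contradiction (<-trans (n<1+n i) (subst (_< m) (punchIn-≥ m≤i) h)) (≤⇒≯ m≤i)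
... | no m≰i = ≰⇒> m≰i

punchIn-bound : ∀ m {n i} → i < n → punchIn m i < suc n
punchIn-bound zero h = s≤s h
punchIn-bound (suc m) {suc n} {zero} h = s≤s z≤n
punchIn-bound (suc m) {suc n} {suc i} (s≤s h) = s≤s (punchIn-bound m h)

punchIn-onto : ∀ {n m j} → m ≤ n → j < suc n → j ≢ m → ∃[ i ] i < n × punchIn m i ≡ j
punchIn-onto {n} {zero} {zero} _ _ j≢m = contradiction refl j≢m
punchIn-onto {n} {zero} {suc j} _ (s≤s h) _ = j , h , refl
punchIn-onto {suc n} {suc m} {zero} _ _ _ = 0 , s≤s z≤n , refl
punchIn-onto {suc n} {suc m} {suc j} (s≤s m≤n) (s≤s h) j≢m =
  let (i , i<n , e) = punchIn-onto m≤n h (j≢m ∘ cong suc) in suc i , s≤s i<n , cong suc e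

pivot-or-punchIn : ∀ {n m j} → m ≤ n → j < suc n → j ≡ m ⊎ ∃[ i ] i < n × punchIn m i ≡ j
pivot-or-punchIn {m = m} {j} m≤n j<1+n with j ≟ m
... | yes j≡m = inj₁ j≡m
... | no j≢m = inj₂ (punchIn-onto m≤n j<1+n j≢m)

<-length-toList : ∀ {n} (v : Vec ℕ n) {i} → i < n → i < length (toList v)
<-length-toList v {i} = subst (i <_) (sym (length-toList v))

<-length-toList⁻ : ∀ {n} (v : Vec ℕ n) {i} → i < length (toList v) → i < n
<-length-toList⁻ v {i} = subst (i <_) (length-toList v)

nth-removeNat : ∀ {n} (v : Vec ℕ (suc n)) m {i} → i < n →
                nth (toList (removeNat v m)) i ≡ nth (toList v) (punchIn m i)
nth-removeNat (x ∷ xs) zero _ = refl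
nth-removeNat (x ∷ y ∷ ys) (suc m) {zero} _ = refl
nth-removeNat (x ∷ y ∷ ys) (suc m) {suc i} (s≤s h) = nth-removeNat (y ∷ ys) m h

removeNat-∷ : ∀ {n} y (v : Vec ℕ (suc n)) p → removeNat (y ∷ v) (suc p) ≡ y ∷ removeNat v p
removeNat-∷ y (z ∷ zs) p = refl

removeNat-insertNat : ∀ {n} p x (v : Vec ℕ n) → removeNat (insertNat p x v) p ≡ v
removeNat-insertNat zero x v = refl
removeNat-insertNat (suc p) x [] = refl
removeNat-insertNat (suc p) x (y ∷ v) =
  trans (removeNat-∷ y (insertNat p x v) p) (cong (y ∷_) (removeNat-insertNat p x v))

insertNat-removeNat : ∀ {n} (v : Vec ℕ (suc n)) {m} → m ≤ n →
                      insertNat m (nth (toList v) m) (removeNat v m) ≡ v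
insertNat-removeNat (x ∷ xs) {zero} _ = refl
insertNat-removeNat (x ∷ y ∷ ys) {suc m} (s≤s h) = cong (x ∷_) (insertNat-removeNat (y ∷ ys) h)

nth-insertNat : ∀ {n} p x (v : Vec ℕ n) → p ≤ n → nth (toList (insertNat p x v)) p ≡ x
nth-insertNat zero x v _ = refl
nth-insertNat (suc p) x (y ∷ v) (s≤s h) = nth-insertNat p x v h

nth-insertNat-punchIn : ∀ {n} p x (v : Vec ℕ n) {i} → i < n →
                        nth (toList (insertNat p x v)) (punchIn p i) ≡ nth (toList v) i
nth-insertNat-punchIn zero x v _ = refl
nth-insertNat-punchIn (suc p) x (y ∷ v) {zero} _ = refl
nth-insertNat-punchIn (suc p) x (y ∷ v) {suc i} (s≤s h) = nth-insertNat-punchIn p x v h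

maxLabel-insertNat : ∀ {n} p x (v : Vec ℕ n) →
                     maxLabel (toList (insertNat p x v)) ≡ x ⊔ maxLabel (toList v)
maxLabel-insertNat zero x v = refl
maxLabel-insertNat (suc p) x [] = refl
maxLabel-insertNat (suc p) x (y ∷ v) =
  trans (cong (y ⊔_) (maxLabel-insertNat p x v)) (x∙yz≈y∙xz y x _)

topPos : ∀ {n} → Vec ℕ n → ℕ
topPos v = blockMax (toList v) (maxLabel (toList v))

parent : ∀ {n} → Vec ℕ (suc n) → Vec ℕ n
parent v = removeNat v (topPos v)

topPos-spec : ∀ {n} (v : Vec ℕ (suc n)) →
              topPos v ≤ n × nth (toList v) (topPos v) ≡ maxLabel (toList v)
topPos-spec v =
  let (i , i<N , e) = maxLabel-attained (toList v) (<-length-toList v (s≤s z≤n))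
      (top<N , e′) = blockMax-∈ (toList v) _ i<N e
  in ≤-pred (<-length-toList⁻ v top<N) , e′

≤-topPos : ∀ {n} (v : Vec ℕ n) {i} → i < n → nth (toList v) i ≡ maxLabel (toList v) → i ≤ topPos v
≤-topPos v h e = ≤-blockMax (toList v) _ (<-length-toList v h) e

module RemoveTop {n} (v : Vec ℕ (suc n)) {m} (m≤n : m ≤ n)
                 (top : nth (toList v) m ≡ maxLabel (toList v)) (valid : Valid (toList v)) where

  nth-r : ∀ {i} → i < n → nth (toList (removeNat v m)) i ≡ nth (toList v) (punchIn m i)
  nth-r = nth-removeNat v m

  maxLabel-removeNat-≤ : maxLabel (toList (removeNat v m)) ≤ maxLabel (toList v)
  maxLabel-removeNat-≤ = maxLabel-lub (toList (removeNat v m)) λ h →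
    let h′ = <-length-toList⁻ (removeNat v m) h in
    subst (_≤ _) (sym (nth-r h′)) (nth≤maxLabel (toList v) (<-length-toList v (punchIn-bound m h′)))

  lower-label-survives : ∀ {j} → 1 ≤ j → j ≤ maxLabel (toList v) → j ≢ maxLabel (toList v) →
                         ∃[ i ] i < n × nth (toList (removeNat v m)) i ≡ j
  lower-label-survives 1≤j j≤K j≢K =
    let (i , i<N , e) = onto valid 1≤j j≤K
        (i′ , i′<n , e′) = punchIn-onto m≤n (<-length-toList⁻ v i<N)
                             (λ i≡m → j≢K (trans (sym e) (trans (cong (nth (toList v)) i≡m) top)))
    in i′ , i′<n , trans (nth-r i′<n) (trans (cong (nth (toList v)) e′) e)

  ≤-suc-maxLabel-removeNat : maxLabel (toList v) ≤ suc (maxLabel (toList (removeNat v m)))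
  ≤-suc-maxLabel-removeNat with maxLabel (toList v) | lower-label-survives {ℕ.pred (maxLabel (toList v))}
  ... | zero | _ = z≤n
  ... | suc zero | _ = s≤s z≤n
  ... | suc (suc k) | survives =
    let (i , i<n , e) = survives (s≤s z≤n) (n≤1+n _) (λ ())
    in s≤s (subst (_≤ _) e (nth≤maxLabel (toList (removeNat v m)) (<-length-toList (removeNat v m) i<n)))

  removeNat-valid : Valid (toList (removeNat v m))
  removeNat-valid = record { positive = pos ; onto = onto′ ; enclosed-larger = el }
    where
      r = removeNat v m
      pos : LabelsPositive (toList r)
      pos h = let h′ = <-length-toList⁻ r h in
        subst (1 ≤_) (sym (nth-r h′)) (positive valid (<-length-toList v (punchIn-bound m h′)))
      onto′ : LabelsOnto (toList r)
      onto′ {j} 1≤j j≤K with j ≟ maxLabel (toList v)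
      ... | no j≢K =
        let (i , i<n , e) = lower-label-survives 1≤j (≤-trans j≤K maxLabel-removeNat-≤) j≢K
        in i , <-length-toList r i<n , e
      ... | yes refl =
        let (i , i<N , e) = maxLabel-attained (toList r) (0<maxLabel⇒0<length (toList r) (≤-trans 1≤j j≤K))
        in i , i<N , trans e (≤-antisym maxLabel-removeNat-≤ j≤K)
      el : EnclosedLarger (toList r)
      el {a} {b} {d} ab bd dN ead ne =
        let d<n = <-length-toList⁻ r dN
            b<n = <-trans bd d<n
            a<n = <-trans ab b<n
        in subst₂ _<_ (sym (nth-r a<n)) (sym (nth-r b<n))
             (enclosed-larger valid (punchIn-mono-< m ab) (punchIn-mono-< m bd)
               (<-length-toList v (punchIn-bound m d<n))
               (trans (sym (nth-r a<n)) (trans ead (nth-r d<n)))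
               (λ e → ne (trans (nth-r b<n) (trans e (sym (nth-r a<n))))))

maxLabel≤length : ∀ {n} (v : Vec ℕ n) → Valid (toList v) → maxLabel (toList v) ≤ n
maxLabel≤length [] _ = z≤n
maxLabel≤length {suc n} v valid =
  let (top≤n , top) = topPos-spec v
      open RemoveTop v top≤n top valid
  in ≤-trans ≤-suc-maxLabel-removeNat (s≤s (maxLabel≤length (removeNat v (topPos v)) removeNat-valid))

parent-valid : ∀ {n} (v : Vec ℕ (suc n)) → Valid (toList v) → Valid (toList (parent v))
parent-valid v valid = let (top≤n , top) = topPos-spec v in RemoveTop.removeNat-valid v top≤n top valid

module Children {n} (ρ : Vec ℕ (suc n)) (valid : Valid (toList ρ)) where

  K M : ℕ
  K = maxLabel (toList ρ)
  M = topPos ρ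

  M≤n : M ≤ n
  M≤n = proj₁ (topPos-spec ρ)

  ρ-M : nth (toList ρ) M ≡ K
  ρ-M = proj₂ (topPos-spec ρ)

  ρ≤K : ∀ {i} → i < suc n → nth (toList ρ) i ≤ K
  ρ≤K h = nth≤maxLabel (toList ρ) (<-length-toList ρ h)

  1≤K : 1 ≤ K
  1≤K = ≤-trans (positive valid (<-length-toList ρ (s≤s z≤n))) (ρ≤K (s≤s z≤n))

  newSingleton : ℕ → Vec ℕ (suc (suc n))
  newSingleton p = insertNat p (suc K) ρ

  extendTop : Vec ℕ (suc (suc n))
  extendTop = insertNat (suc M) K ρ

  children : List (Vec ℕ (suc (suc n)))
  children = extendTop ∷ applyUpTo newSingleton (suc (suc n))

  module Insert (p x : ℕ) (p≤N : p ≤ suc n) where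

    c : Vec ℕ (suc (suc n))
    c = insertNat p x ρ

    c-p : nth (toList c) p ≡ x
    c-p = nth-insertNat p x ρ p≤N

    c-punchIn : ∀ {i} → i < suc n → nth (toList c) (punchIn p i) ≡ nth (toList ρ) i
    c-punchIn = nth-insertNat-punchIn p x ρ

    position : ∀ {j} → j < length (toList c) → j ≡ p ⊎ ∃[ i ] i < suc n × punchIn p i ≡ j
    position h = pivot-or-punchIn p≤N (<-length-toList⁻ c h)

    c-positive : 1 ≤ x → LabelsPositive (toList c)
    c-positive 1≤x h with position h
    ... | inj₁ refl = subst (1 ≤_) (sym c-p) 1≤x
    ... | inj₂ (i , i<N , refl) = subst (1 ≤_) (sym (c-punchIn i<N)) (positive valid (<-length-toList ρ i<N))

    old-label-onto : ∀ {j} → 1 ≤ j → j ≤ K → ∃[ i ] i < length (toList c) × nth (toList c) i ≡ j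
    old-label-onto 1≤j j≤K =
      let (i , i<N , e) = onto valid 1≤j j≤K
          i<n = <-length-toList⁻ ρ i<N
      in punchIn p i , <-length-toList c (punchIn-bound p i<n) , trans (c-punchIn i<n) e

    old-enclosed-larger : ∀ {a b d} → a < suc n → b < suc n → d < suc n →
      punchIn p a < punchIn p b → punchIn p b < punchIn p d →
      nth (toList c) (punchIn p a) ≡ nth (toList c) (punchIn p d) →
      nth (toList c) (punchIn p b) ≢ nth (toList c) (punchIn p a) →
      nth (toList c) (punchIn p a) < nth (toList c) (punchIn p b)
    old-enclosed-larger a<N b<N d<N ab bd ead ne =
      subst₂ _<_ (sym (c-punchIn a<N)) (sym (c-punchIn b<N))
        (enclosed-larger valid (punchIn-cancel-< p ab) (punchIn-cancel-< p bd) (<-length-toList ρ d<N)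
          (trans (sym (c-punchIn a<N)) (trans ead (c-punchIn d<N)))
          (λ e → ne (trans (c-punchIn b<N) (trans e (sym (c-punchIn a<N))))))

    parent-c : (∀ {j} → j < length (toList c) → nth (toList c) j ≡ maxLabel (toList c) → j ≤ p) →
               x ≡ maxLabel (toList c) → parent c ≡ ρ
    parent-c last top = trans (cong (removeNat c) (blockMax-≡ (toList c) _ (<-length-toList c (s≤s p≤N)) (trans c-p top) last))
                              (removeNat-insertNat p x ρ)

  module NewSingleton (p : ℕ) (p≤N : p ≤ suc n) where
    open Insert p (suc K) p≤N

    maxLabel-c : maxLabel (toList c) ≡ suc K
    maxLabel-c = trans (maxLabel-insertNat p (suc K) ρ) (m≥n⇒m⊔n≡m (n≤1+n K))

    valid-c : Valid (toList c)
    valid-c = record { positive = c-positive (s≤s z≤n) ; onto = onto′ ; enclosed-larger = el }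
      where
        onto′ : LabelsOnto (toList c)
        onto′ {j} 1≤j j≤K′ with j ≟ suc K
        ... | yes refl = p , <-length-toList c (s≤s p≤N) , c-p
        ... | no j≢1+K = old-label-onto 1≤j (≤-pred (≤∧≢⇒< (subst (j ≤_) maxLabel-c j≤K′) j≢1+K))
        el : EnclosedLarger (toList c)
        el ab bd dN ead ne with position (<-trans ab (<-trans bd dN)) | position (<-trans bd dN) | position dN
        ... | inj₁ refl | inj₁ refl | _ = contradiction ab (<-irrefl refl)
        ... | inj₂ (a , a<N , refl) | inj₁ refl | _ =
              subst₂ _<_ (sym (c-punchIn a<N)) (sym c-p) (s≤s (ρ≤K a<N))
        ... | inj₁ refl | inj₂ _ | inj₁ refl = contradiction (<-trans ab bd) (<-irrefl refl)
        ... | inj₁ refl | inj₂ _ | inj₂ (d , d<N , refl) =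
              contradiction (subst (_≤ K) (trans (sym (c-punchIn d<N)) (trans (sym ead) c-p)) (ρ≤K d<N)) 1+n≰n
        ... | inj₂ (a , a<N , refl) | inj₂ _ | inj₁ refl =
              contradiction (subst (_≤ K) (trans (sym (c-punchIn a<N)) (trans ead c-p)) (ρ≤K a<N)) 1+n≰n
        ... | inj₂ (a , a<N , refl) | inj₂ (b , b<N , refl) | inj₂ (d , d<N , refl) =
              old-enclosed-larger a<N b<N d<N ab bd ead ne

    parent-newSingleton : parent c ≡ ρ
    parent-newSingleton = parent-c last (sym maxLabel-c)
      where
        last : ∀ {j} → j < length (toList c) → nth (toList c) j ≡ maxLabel (toList c) → j ≤ p
        last h e with position h
        ... | inj₁ refl = ≤-refl
        ... | inj₂ (i , i<N , refl) =
              contradiction (subst (_≤ K) (trans (sym (c-punchIn i<N)) (trans e maxLabel-c)) (ρ≤K i<N)) 1+n≰n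

  module ExtendTop where
    open Insert (suc M) K (s≤s M≤n)

    maxLabel-c : maxLabel (toList c) ≡ K
    maxLabel-c = trans (maxLabel-insertNat (suc M) K ρ) (⊔-idem K)

    top-before-M : ∀ {i} → i < suc n → nth (toList ρ) i ≡ K → i ≤ M
    top-before-M h e = ≤-topPos ρ h e

    punchIn-top : ∀ {i} → i < suc n → nth (toList ρ) i ≡ K → punchIn (suc M) i ≡ i
    punchIn-top h e = punchIn-< (s≤s (top-before-M h e))

    valid-c : Valid (toList c)
    valid-c = record { positive = c-positive 1≤K ; onto = onto′ ; enclosed-larger = el }
      where
        onto′ : LabelsOnto (toList c)
        onto′ 1≤j j≤K′ = old-label-onto 1≤j (subst (_ ≤_) maxLabel-c j≤K′)
        el : EnclosedLarger (toList c)
        el ab bd dN ead ne with position (<-trans ab (<-trans bd dN)) | position (<-trans bd dN) | position dN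
        ... | inj₁ refl | inj₁ refl | _ = contradiction ab (<-irrefl refl)
        ... | inj₂ (a , a<N , refl) | inj₁ refl | _ =
              subst₂ _<_ (sym (c-punchIn a<N)) (sym c-p)
                (≤∧≢⇒< (ρ≤K a<N) (λ e → ne (trans c-p (trans (sym e) (sym (c-punchIn a<N))))))
        ... | inj₁ refl | inj₂ _ | inj₁ refl = contradiction (<-trans ab bd) (<-irrefl refl)
        ... | inj₁ refl | inj₂ _ | inj₂ (d , d<N , refl) =
              let ρ-d = trans (sym (c-punchIn d<N)) (trans (sym ead) c-p)
              in contradiction (<-trans ab bd) (<-asym (subst (_< suc M) (sym (punchIn-top d<N ρ-d)) (s≤s (top-before-M d<N ρ-d))))
        ... | inj₂ (a , a<N , refl) | inj₂ (b , b<N , refl) | inj₁ refl =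
              let ρ-a = trans (sym (c-punchIn a<N)) (trans ead c-p)
                  b≤M = ≤-pred (punchIn-<-cancel bd)
                  ρb≢ρa : nth (toList ρ) b ≢ nth (toList ρ) a
                  ρb≢ρa e = ne (trans (c-punchIn b<N) (trans e (sym (c-punchIn a<N))))
                  b<M = ≤∧≢⇒< b≤M (λ b≡M → ρb≢ρa (trans (cong (nth (toList ρ)) b≡M) (trans ρ-M (sym ρ-a))))
              in subst₂ _<_ (sym (c-punchIn a<N)) (sym (c-punchIn b<N))
                   (enclosed-larger valid (punchIn-cancel-< (suc M) ab) b<M (<-length-toList ρ (s≤s M≤n))
                     (trans ρ-a (sym ρ-M)) ρb≢ρa)
        ... | inj₂ (a , a<N , refl) | inj₂ (b , b<N , refl) | inj₂ (d , d<N , refl) =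
              old-enclosed-larger a<N b<N d<N ab bd ead ne

    parent-extendTop : parent c ≡ ρ
    parent-extendTop = parent-c last (sym maxLabel-c)
      where
        last : ∀ {j} → j < length (toList c) → nth (toList c) j ≡ maxLabel (toList c) → j ≤ suc M
        last h e with position h
        ... | inj₁ refl = ≤-refl
        ... | inj₂ (i , i<N , refl) =
              let ρ-i = trans (sym (c-punchIn i<N)) (trans e maxLabel-c)
              in subst (_≤ suc M) (sym (punchIn-top i<N ρ-i)) (m≤n⇒m≤1+n (top-before-M i<N ρ-i))

  ∈-children⇒ : ∀ {π} → π ∈ children → Valid (toList π) × parent π ≡ ρ
  ∈-children⇒ (here refl) = ExtendTop.valid-c , ExtendTop.parent-extendTop
  ∈-children⇒ (there π∈) with ∈-applyUpTo⁻ newSingleton π∈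
  ... | p , p<N , refl = NewSingleton.valid-c p (≤-pred p<N) , NewSingleton.parent-newSingleton p (≤-pred p<N)

  module Reinsert (π : Vec ℕ (suc (suc n))) (valid-π : Valid (toList π)) (parent-π : parent π ≡ ρ) where
    m : ℕ
    m = topPos π
    m≤N : m ≤ suc n
    m≤N = proj₁ (topPos-spec π)
    open RemoveTop π m≤N (proj₂ (topPos-spec π)) valid-π
    π≡ : π ≡ insertNat m (maxLabel (toList π)) ρ
    π≡ = trans (sym (insertNat-removeNat π m≤N)) (cong₂ (insertNat m) (proj₂ (topPos-spec π)) parent-π)
    K≤Kπ : K ≤ maxLabel (toList π)
    K≤Kπ = subst (λ r → maxLabel (toList r) ≤ _) parent-π maxLabel-removeNat-≤
    Kπ≤1+K : maxLabel (toList π) ≤ suc K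
    Kπ≤1+K = subst (λ r → _ ≤ suc (maxLabel (toList r))) parent-π ≤-suc-maxLabel-removeNat

  -- K recurs at M, so M < m; and a point strictly between M and m would lie
  -- inside the top block without belonging to it, so its label would exceed K.
  extension-topPos : (π : Vec ℕ (suc (suc n))) → Valid (toList π) →
                     π ≡ insertNat (topPos π) K ρ → topPos π ≡ suc M
  extension-topPos π valid-π π≡ = ≤-antisym m≤1+M M<m
    where
      m≤N = proj₁ (topPos-spec π)
      open Insert (topPos π) K m≤N
      m = topPos π
      π-c : ∀ j → nth (toList π) j ≡ nth (toList c) j
      π-c j = cong (λ v → nth (toList v) j) π≡
      maxLabel-π : maxLabel (toList π) ≡ K
      maxLabel-π = trans (cong (maxLabel ∘ toList) π≡) (trans (maxLabel-insertNat m K ρ) (⊔-idem K))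
      π-M′ : nth (toList π) (punchIn m M) ≡ maxLabel (toList π)
      π-M′ = trans (π-c _) (trans (c-punchIn (s≤s M≤n)) (trans ρ-M (sym maxLabel-π)))
      M<m : M < m
      M<m = punchIn-<-cancel (≤∧≢⇒< (≤-topPos π (punchIn-bound m (s≤s M≤n)) π-M′) (punchIn≢ m M))
      m≤1+M : m ≤ suc M
      m≤1+M with m ≤? suc M
      ... | yes m≤1+M = m≤1+M
      ... | no m≰1+M = contradiction (nth≤maxLabel (toList π) (<-length-toList π (m<n⇒m<1+n 1+M<N))) (<⇒≱ (subst (_< nth (toList π) (suc M)) (sym maxLabel-π) K<π-1+M))
        where
          1+M<m = ≰⇒> m≰1+M
          1+M<N = <-≤-trans 1+M<m m≤N
          π-1+M : nth (toList π) (suc M) ≡ nth (toList ρ) (suc M)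
          π-1+M = trans (π-c _) (trans (cong (nth (toList c)) (sym (punchIn-< 1+M<m))) (c-punchIn 1+M<N))
          π-M : nth (toList π) M ≡ K
          π-M = trans (cong (nth (toList π)) (sym (punchIn-< M<m))) (trans π-M′ maxLabel-π)
          K<π-1+M : K < nth (toList π) (suc M)
          K<π-1+M = subst (_< nth (toList π) (suc M)) π-M
            (enclosed-larger valid-π (n<1+n M) 1+M<m (<-length-toList π (s≤s m≤N))
              (trans π-M (sym (trans (proj₂ (topPos-spec π)) maxLabel-π)))
              (λ e → 1+n≰n (≤-topPos ρ 1+M<N (trans (sym π-1+M) (trans e π-M)))))

  children-complete : (π : Vec ℕ (suc (suc n))) → Valid (toList π) → parent π ≡ ρ → π ∈ children
  children-complete π valid-π parent-π with maxLabel (toList π) ≟ suc K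
  ... | yes Kπ≡1+K = there (subst (_∈ applyUpTo newSingleton (suc (suc n)))
                              (sym (trans π≡ (cong (λ x → insertNat m x ρ) Kπ≡1+K)))
                              (∈-applyUpTo⁺ newSingleton (s≤s m≤N)))
    where open Reinsert π valid-π parent-π
  ... | no Kπ≢1+K = here (trans π≡K (cong (λ p → insertNat p K ρ)
                            (extension-topPos π valid-π π≡K)))
    where
      open Reinsert π valid-π parent-π
      π≡K = trans π≡ (cong (λ x → insertNat m x ρ) (≤-antisym (≤-pred (≤∧≢⇒< Kπ≤1+K Kπ≢1+K)) K≤Kπ))

  newSingleton-p : ∀ {p} → p ≤ suc n → nth (toList (newSingleton p)) p ≡ suc K
  newSingleton-p {p} = nth-insertNat p (suc K) ρ

  newSingleton-injective : ∀ {i j} → i < j → j < suc (suc n) → newSingleton i ≢ newSingleton j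
  newSingleton-injective {i} {j} i<j j<N e =
    let (i′ , i′<n , e′) = punchIn-onto (≤-pred j<N) (<-trans i<j j<N) (<⇒≢ i<j)
        ρ-i′ = trans (sym (nth-insertNat-punchIn j (suc K) ρ i′<n))
                 (trans (cong (nth (toList (newSingleton j))) e′)
                   (trans (cong (λ v → nth (toList v) i) (sym e)) (newSingleton-p (≤-pred (<-trans i<j j<N)))))
    in contradiction (subst (_≤ K) ρ-i′ (ρ≤K i′<n)) 1+n≰n

  extendTop≢newSingleton : ∀ {p} → p < suc (suc n) → extendTop ≢ newSingleton p
  extendTop≢newSingleton {p} p<N e =
    contradiction (subst (_≤ K) (trans (cong (λ v → nth (toList v) p) e) (newSingleton-p (≤-pred p<N)))
                    (subst (nth (toList extendTop) p ≤_) ExtendTop.maxLabel-c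
                      (nth≤maxLabel (toList extendTop) (<-length-toList extendTop p<N))))
                  1+n≰n

  children-unique : Unique children
  children-unique = applyUpTo⁺₁ newSingleton (suc (suc n)) extendTop≢newSingleton
                  ∷ Unique.applyUpTo⁺₁ newSingleton (suc (suc n)) newSingleton-injective

  length-children : length children ≡ suc (suc (suc n))
  length-children = cong suc (length-applyUpTo newSingleton (suc (suc n)))

labels-injective : ∀ {n} {π π′ : NCm n} → labels π ≡ labels π′ → π ≡ π′
labels-injective {π = mkNCm v p} {mkNCm .v p′} refl = cong (mkNCm v) (T-irrelevant p p′)

NCm-valid : ∀ {n} (π : NCm n) → Valid (toList (labels π))
NCm-valid π = isMton⇒Valid _ (valid π)

∈-allVecs : ∀ {n k} (v : Vec ℕ n) → (∀ {i} → i < n → 1 ≤ nth (toList v) i × nth (toList v) i ≤ k) →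
            v ∈ allVecs n k
∈-allVecs [] _ = here refl
∈-allVecs {suc n} {k} (x ∷ v) bounds =
  ∈-concat⁺′ (∈-map⁺ (x ∷_) (∈-allVecs v (bounds ∘ s≤s)))
             (∈-map⁺ (λ y → map (y ∷_) (allVecs n k)) (∈-labels1to⁺ (proj₁ (bounds (s≤s z≤n))) (proj₂ (bounds (s≤s z≤n)))))

allVecs-unique : ∀ n k → Unique (allVecs n k)
allVecs-unique zero k = [] ∷ []
allVecs-unique (suc n) k =
  Unique.concat⁺ (All.map⁺ (All.tabulate λ _ → Unique.map⁺ ∷-injectiveʳ (allVecs-unique n k)))
                 (AllPairs.map⁺ (AllPairs.map disjoint (Unique.map⁺ suc-injective (Unique.upTo⁺ k))))
  where
    disjoint : ∀ {x y} → x ≢ y → ∀ {v} → ¬ (v ∈ map (x ∷_) (allVecs n k) × v ∈ map (y ∷_) (allVecs n k))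
    disjoint x≢y (v∈x , v∈y) with ∈-map⁻ _ v∈x | ∈-map⁻ _ v∈y
    ... | _ , _ , refl | _ , _ , e = x≢y (∷-injectiveˡ e)

valid⇒∈-allVecs : ∀ {n} (v : Vec ℕ n) → Valid (toList v) → v ∈ allVecs n n
valid⇒∈-allVecs v valid = ∈-allVecs v λ h →
  positive valid (<-length-toList v h) ,
  ≤-trans (nth≤maxLabel (toList v) (<-length-toList v h)) (maxLabel≤length v valid)

labels-concatMap-toNCm : ∀ {n} (vs : List (Vec ℕ n)) →
                         map labels (concatMap toNCm vs) ≡ filter (T? ∘ isMton ∘ toList) vs
labels-concatMap-toNCm [] = refl
labels-concatMap-toNCm (v ∷ vs) with T? (isMton (toList v))
... | yes valid = trans (cong (v ∷_) (labels-concatMap-toNCm vs)) (sym (filter-accept (T? ∘ isMton ∘ toList) {v} valid))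
... | no invalid = trans (labels-concatMap-toNCm vs) (sym (filter-reject (T? ∘ isMton ∘ toList) {v} invalid))

enumNCm-unique : ∀ n → Unique (enumNCm n)
enumNCm-unique n = Unique.map⁻ (subst Unique (sym (labels-concatMap-toNCm (allVecs n n)))
                                  (Unique.filter⁺ (T? ∘ isMton ∘ toList) (allVecs-unique n n)))

∈-enumNCm : ∀ {n} (π : NCm n) → π ∈ enumNCm n
∈-enumNCm {n} π =
  let labels∈ = subst (labels π ∈_) (sym (labels-concatMap-toNCm (allVecs n n)))
                  (∈-filter⁺ (T? ∘ isMton ∘ toList) (valid⇒∈-allVecs (labels π) (NCm-valid π)) (valid π))
      (π′ , π′∈ , e) = ∈-map⁻ labels labels∈
  in subst (_∈ enumNCm n) (sym (labels-injective e)) π′∈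

length-filter-enumNCm : ∀ {n} (P : NCm n → Bool) (vs : List (Vec ℕ n)) → Unique vs →
  (∀ {v} → v ∈ vs → Valid (toList v)) → (∀ π → labels π ∈ vs ⇔ T (P π)) →
  length (filterᵇ P (enumNCm n)) ≡ length vs
length-filter-enumNCm {n} P vs vs-unique vs-valid vs⇔P = begin
  length (filterᵇ P (enumNCm n))              ≡⟨ length-map labels (filterᵇ P (enumNCm n)) ⟨
  length (map labels (filterᵇ P (enumNCm n))) ≡⟨ ↭-length (∼bag⇒↭ (unique∧set⇒bag selected-unique vs-unique same)) ⟩
  length vs                                   ∎
  where
    open ≡-Reasoning
    selected-unique : Unique (map labels (filterᵇ P (enumNCm n)))
    selected-unique = Unique.map⁺ labels-injective (Unique.filter⁺ (T? ∘ P) (enumNCm-unique n))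
    same : map labels (filterᵇ P (enumNCm n)) ∼[ set ] vs
    same = mk⇔ selected⇒ ⇒selected
      where
        selected⇒ : ∀ {v} → v ∈ map labels (filterᵇ P (enumNCm n)) → v ∈ vs
        selected⇒ v∈ = let (π , π∈ , e) = ∈-map⁻ labels v∈
                       in subst (_∈ vs) (sym e) (from (vs⇔P π) (proj₂ (∈-filter⁻ (T? ∘ P) {xs = enumNCm n} π∈)))
        ⇒selected : ∀ {v} → v ∈ vs → v ∈ map labels (filterᵇ P (enumNCm n))
        ⇒selected {v} v∈ = let π = mkNCm v (Valid⇒isMton (toList v) (vs-valid v∈)) in
          ∈-map⁺ labels (∈-filter⁺ (T? ∘ P) (∈-enumNCm π) (to (vs⇔P π) v∈))

T-pointwise-≡ᵇ : ∀ {n} (u v : Vec ℕ n) → T (Vec.foldr _ _∧_ true (Vec.zipWith ℕ._≡ᵇ_ u v)) ⇔ u ≡ v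
T-pointwise-≡ᵇ [] [] = mk⇔ (λ _ → refl) (λ _ → _)
T-pointwise-≡ᵇ (x ∷ u) (y ∷ v) = mk⇔
  (λ t → let (x≡y , u≡v) = to T-∧ t in cong₂ _∷_ (≡ᵇ⇒≡ x y x≡y) (to (T-pointwise-≡ᵇ u v) u≡v))
  (λ e → T-∧⁺ (≡⇒≡ᵇ x y (∷-injectiveˡ e)) (from (T-pointwise-≡ᵇ u v) (∷-injectiveʳ e)))

inC⇔ : ∀ {n} (ρ : NCm n) (π : NCm (suc n)) → T (inC ρ π) ⇔ parent (labels π) ≡ labels ρ
inC⇔ ρ π = T-pointwise-≡ᵇ (parent (labels π)) (labels ρ)

parent-unique : ∀ {n} (π : NCm (suc n)) → length (filterᵇ (λ ρ → inC ρ π) (enumNCm n)) ≡ 1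
parent-unique π = length-filter-enumNCm _ (parent (labels π) ∷ []) ([] ∷ [])
  (λ { (here refl) → parent-valid (labels π) (NCm-valid π) ; (there ()) })
  (λ ρ → mk⇔ (λ { (here e) → from (inC⇔ ρ π) (sym e) ; (there ()) }) (λ t → here (sym (to (inC⇔ ρ π) t))))

number-of-children : ∀ {n} (ρ : NCm (suc n)) →
                     length (filterᵇ (inC ρ) (enumNCm (suc (suc n)))) ≡ suc (suc (suc n))
number-of-children ρ = trans
  (length-filter-enumNCm (inC ρ) children children-unique (proj₁ ∘ ∈-children⇒)
    λ π → mk⇔ (λ π∈ → from (inC⇔ ρ π) (proj₂ (∈-children⇒ π∈)))
               (λ t → children-complete (labels π) (NCm-valid π) (to (inC⇔ ρ π) t)))
  length-children
  where open Children (labels ρ) (NCm-valid ρ)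

fromℤ-+ : ∀ a b → fromℤ (a ℤ.+ b) ≡ fromℤ a ℚ.+ fromℤ b
fromℤ-+ a b = ℚP.toℚᵘ-injective (begin
  ℚ.toℚᵘ (fromℤ (a ℤ.+ b))              ≈⟨ ℚP.toℚᵘ-fromℚᵘ (ℚᵘ.mkℚᵘ (a ℤ.+ b) 0) ⟩
  ℚᵘ.mkℚᵘ (a ℤ.+ b) 0                   ≈⟨ ℚᵘ.*≡* (cong (ℤ._* + 1) (sym (cong₂ ℤ._+_ (ℤP.*-identityʳ a) (ℤP.*-identityʳ b)))) ⟩
  ℚᵘ.mkℚᵘ a 0 ℚᵘ.+ ℚᵘ.mkℚᵘ b 0          ≈⟨ ℚᵘP.+-cong (ℚP.toℚᵘ-fromℚᵘ (ℚᵘ.mkℚᵘ a 0)) (ℚP.toℚᵘ-fromℚᵘ (ℚᵘ.mkℚᵘ b 0)) ⟨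
  ℚ.toℚᵘ (fromℤ a) ℚᵘ.+ ℚ.toℚᵘ (fromℤ b) ≈⟨ ℚP.toℚᵘ-homo-+ (fromℤ a) (fromℤ b) ⟨
  ℚ.toℚᵘ (fromℤ a ℚ.+ fromℤ b)          ∎)
  where open ℚᵘP.≃-Reasoning

fromℤ-neg : ∀ a → fromℤ (ℤ.- a) ≡ ℚ.- fromℤ a
fromℤ-neg a = ℚP.toℚᵘ-injective (begin
  ℚ.toℚᵘ (fromℤ (ℤ.- a))    ≈⟨ ℚP.toℚᵘ-fromℚᵘ (ℚᵘ.mkℚᵘ (ℤ.- a) 0) ⟩
  ℚᵘ.mkℚᵘ (ℤ.- a) 0         ≈⟨ ℚᵘP.-‿cong (ℚP.toℚᵘ-fromℚᵘ (ℚᵘ.mkℚᵘ a 0)) ⟨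
  ℚᵘ.- ℚ.toℚᵘ (fromℤ a)     ≈⟨ ℚP.toℚᵘ-homo‿- (fromℤ a) ⟨
  ℚ.toℚᵘ (ℚ.- fromℤ a)      ∎)
  where open ℚᵘP.≃-Reasoning

fromℤ-minus : ∀ a b → fromℤ (a ℤ.- b) ≡ fromℤ a ℚ.- fromℤ b
fromℤ-minus a b = trans (fromℤ-+ a (ℤ.- b)) (cong (fromℤ a ℚ.+_) (fromℤ-neg b))

powℕ-+ : ∀ x m n → powℕ x (m ℕ.+ n) ≡ powℕ x m ℚ.* powℕ x n
powℕ-+ x zero n = sym (ℚP.*-identityˡ _)
powℕ-+ x (suc m) n = trans (cong (x ℚ.*_) (powℕ-+ x m n)) (sym (ℚP.*-assoc x _ _))

module _ (t : ℚ) (t>0 : 0ℚ ℚ.< t) where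

  private
    t⁻¹ = ℚ.1/_ t {{>-nonZero t>0}}

  powℤ-⊖ : ∀ m n → powℤ t t>0 (m ⊖ n) ≡ powℕ t m ℚ.* powℕ t⁻¹ n
  powℤ-⊖ zero zero = refl
  powℤ-⊖ (suc m) zero = sym (ℚP.*-identityʳ _)
  powℤ-⊖ zero (suc n) = sym (ℚP.*-identityˡ _)
  powℤ-⊖ (suc m) (suc n) = begin
    powℤ t t>0 (suc m ⊖ suc n)                    ≡⟨ cong (powℤ t t>0) (ℤP.[1+m]⊖[1+n]≡m⊖n m n) ⟩
    powℤ t t>0 (m ⊖ n)                            ≡⟨ powℤ-⊖ m n ⟩
    powℕ t m ℚ.* powℕ t⁻¹ n                       ≡⟨ ℚP.*-identityˡ _ ⟨
    1ℚ ℚ.* (powℕ t m ℚ.* powℕ t⁻¹ n)              ≡⟨ cong (ℚ._* (powℕ t m ℚ.* powℕ t⁻¹ n)) (ℚP.*-inverseʳ t {{>-nonZero t>0}}) ⟨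
    (t ℚ.* t⁻¹) ℚ.* (powℕ t m ℚ.* powℕ t⁻¹ n)     ≡⟨ solve 4 (λ t u a b → (t :* u) :* (a :* b) := (t :* a) :* (u :* b)) refl t t⁻¹ (powℕ t m) (powℕ t⁻¹ n) ⟩
    (t ℚ.* powℕ t m) ℚ.* (t⁻¹ ℚ.* powℕ t⁻¹ n)     ∎
    where
      open ≡-Reasoning
      open ℚ-Solver.+-*-Solver

  powℤ-+ : ∀ a b → powℤ t t>0 (a ℤ.+ b) ≡ powℤ t t>0 a ℚ.* powℤ t t>0 b
  powℤ-+ (+ m) (+ n) = powℕ-+ t m n
  powℤ-+ (+ m) -[1+ n ] = powℤ-⊖ m (suc n)
  powℤ-+ -[1+ m ] (+ n) = trans (powℤ-⊖ n (suc m)) (ℚP.*-comm (powℕ t n) (powℕ t⁻¹ (suc m)))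
  powℤ-+ -[1+ m ] -[1+ n ] = begin
    t⁻¹ ℚ.* powℕ t⁻¹ (suc (m ℕ.+ n))          ≡⟨ cong (t⁻¹ ℚ.*_) (powℕ-+ t⁻¹ (suc m) n) ⟩
    t⁻¹ ℚ.* (powℕ t⁻¹ (suc m) ℚ.* powℕ t⁻¹ n) ≡⟨ solve 3 (λ u a b → u :* (a :* b) := a :* (u :* b)) refl t⁻¹ (powℕ t⁻¹ (suc m)) (powℕ t⁻¹ n) ⟩
    powℕ t⁻¹ (suc m) ℚ.* (t⁻¹ ℚ.* powℕ t⁻¹ n) ∎
    where
      open ≡-Reasoning
      open ℚ-Solver.+-*-Solver

  powℤ-shift : ∀ a z → powℤ t t>0 (a ℤ.+ + 1) ℚ.* powℤ t t>0 (z ℤ.- + 1) ≡ powℤ t t>0 a ℚ.* powℤ t t>0 z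
  powℤ-shift a z = begin
    powℤ t t>0 (a ℤ.+ + 1) ℚ.* powℤ t t>0 (z ℤ.- + 1) ≡⟨ powℤ-+ (a ℤ.+ + 1) (z ℤ.- + 1) ⟨
    powℤ t t>0 ((a ℤ.+ + 1) ℤ.+ (z ℤ.- + 1))          ≡⟨ cong (powℤ t t>0) (solve 2 (λ a z → (a :+ con (+ 1)) :+ (z :- con (+ 1)) := a :+ z) refl a z) ⟩
    powℤ t t>0 (a ℤ.+ z)                              ≡⟨ powℤ-+ a z ⟩
    powℤ t t>0 a ℚ.* powℤ t t>0 z                     ∎
    where
      open ≡-Reasoning
      open ℤ-Solver.+-*-Solver

∑ : ∀ {A : Set} → List A → (A → ℚ) → ℚ
∑ xs f = sumℚ (map f xs)

syntax ∑ xs (λ x → e) = ∑[ x ∈ xs ] e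

module _ {A : Set} where

  ∑-cong : ∀ (xs : List A) {f g : A → ℚ} → (∀ {x} → x ∈ xs → f x ≡ g x) → ∑ xs f ≡ ∑ xs g
  ∑-cong [] _ = refl
  ∑-cong (x ∷ xs) f≡g = cong₂ ℚ._+_ (f≡g (here refl)) (∑-cong xs (f≡g ∘ there))

  ∑-zero : ∀ (xs : List A) → ∑[ x ∈ xs ] 0ℚ ≡ 0ℚ
  ∑-zero [] = refl
  ∑-zero (x ∷ xs) = trans (ℚP.+-identityˡ _) (∑-zero xs)

  ∑-+ : ∀ (xs : List A) (f g : A → ℚ) → ∑[ x ∈ xs ] (f x ℚ.+ g x) ≡ ∑ xs f ℚ.+ ∑ xs g
  ∑-+ [] f g = refl
  ∑-+ (x ∷ xs) f g = trans (cong (f x ℚ.+ g x ℚ.+_) (∑-+ xs f g))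
    (solve 4 (λ a b c d → (a :+ b) :+ (c :+ d) := (a :+ c) :+ (b :+ d)) refl (f x) (g x) (∑ xs f) (∑ xs g))
    where open ℚ-Solver.+-*-Solver

  ∑-*ˡ : ∀ (xs : List A) a (f : A → ℚ) → ∑[ x ∈ xs ] (a ℚ.* f x) ≡ a ℚ.* ∑ xs f
  ∑-*ˡ [] a f = sym (ℚP.*-zeroʳ a)
  ∑-*ˡ (x ∷ xs) a f = trans (cong (a ℚ.* f x ℚ.+_) (∑-*ˡ xs a f)) (sym (ℚP.*-distribˡ-+ a _ _))

  ∑-linear : ∀ (xs : List A) a b (f g : A → ℚ) →
             ∑[ x ∈ xs ] (a ℚ.* f x ℚ.+ b ℚ.* g x) ≡ a ℚ.* ∑ xs f ℚ.+ b ℚ.* ∑ xs g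
  ∑-linear xs a b f g = trans (∑-+ xs _ _) (cong₂ ℚ._+_ (∑-*ˡ xs a f) (∑-*ˡ xs b g))

  ∑-filterᵇ : ∀ (P : A → Bool) xs (f : A → ℚ) → ∑ (filterᵇ P xs) f ≡ ∑[ x ∈ xs ] (if P x then f x else 0ℚ)
  ∑-filterᵇ P [] f = refl
  ∑-filterᵇ P (x ∷ xs) f with P x
  ... | true = cong (f x ℚ.+_) (∑-filterᵇ P xs f)
  ... | false = trans (∑-filterᵇ P xs f) (sym (ℚP.+-identityˡ _))

  ∑-filterᵇ-const : ∀ (P : A → Bool) xs (f : A → ℚ) c → (∀ x → T (P x) → f x ≡ c) →
                    ∑ (filterᵇ P xs) f ≡ fromℤ (+ length (filterᵇ P xs)) ℚ.* c
  ∑-filterᵇ-const P [] f c _ = sym (ℚP.*-zeroˡ c)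
  ∑-filterᵇ-const P (x ∷ xs) f c f≡c with P x in Px
  ... | false = ∑-filterᵇ-const P xs f c f≡c
  ... | true = begin
    f x ℚ.+ ∑ (filterᵇ P xs) f                ≡⟨ cong₂ ℚ._+_ (f≡c x (subst T (sym Px) _)) (∑-filterᵇ-const P xs f c f≡c) ⟩
    c ℚ.+ fromℤ (+ k) ℚ.* c                   ≡⟨ solve 2 (λ c k → c :+ k :* c := (con 1ℚ :+ k) :* c) refl c (fromℤ (+ k)) ⟩
    (1ℚ ℚ.+ fromℤ (+ k)) ℚ.* c                ≡⟨ cong (ℚ._* c) (fromℤ-+ (+ 1) (+ k)) ⟨
    fromℤ (+ suc k) ℚ.* c                     ∎
    where
      open ≡-Reasoning
      open ℚ-Solver.+-*-Solver
      k = length (filterᵇ P xs)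

  ∑-filterᵇ-split : ∀ (P Q : A → Bool) xs (f : A → ℚ) →
    ∑ (filterᵇ P xs) f ≡ ∑ (filterᵇ (λ x → P x ∧ Q x) xs) f ℚ.+ ∑ (filterᵇ (λ x → P x ∧ not (Q x)) xs) f
  ∑-filterᵇ-split P Q [] f = refl
  ∑-filterᵇ-split P Q (x ∷ xs) f with P x | Q x | ∑-filterᵇ-split P Q xs f
  ... | false | _ | split = split
  ... | true | true | split = trans (cong (f x ℚ.+_) split) (sym (ℚP.+-assoc (f x) _ _))
  ... | true | false | split = trans (cong (f x ℚ.+_) split)
    (solve 3 (λ a b c → a :+ (b :+ c) := b :+ (a :+ c)) refl (f x) (∑ (filterᵇ (λ x → P x ∧ Q x) xs) f)
                                                                 (∑ (filterᵇ (λ x → P x ∧ not (Q x)) xs) f))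
    where open ℚ-Solver.+-*-Solver

  length-filterᵇ-split : ∀ (P Q : A → Bool) xs →
    length (filterᵇ P xs) ≡ length (filterᵇ (λ x → P x ∧ Q x) xs) ℕ.+ length (filterᵇ (λ x → P x ∧ not (Q x)) xs)
  length-filterᵇ-split P Q [] = refl
  length-filterᵇ-split P Q (x ∷ xs) with P x | Q x | length-filterᵇ-split P Q xs
  ... | false | _ | split = split
  ... | true | true | split = cong suc split
  ... | true | false | split = trans (cong suc split) (sym (+-suc _ _))

∑-swap : ∀ {A B : Set} (xs : List A) (ys : List B) (f : A → B → ℚ) →
         ∑[ x ∈ xs ] ∑[ y ∈ ys ] f x y ≡ ∑[ y ∈ ys ] ∑[ x ∈ xs ] f x y
∑-swap [] ys f = sym (∑-zero ys)
∑-swap (x ∷ xs) ys f = trans (cong (∑ ys (f x) ℚ.+_) (∑-swap xs ys f)) (sym (∑-+ ys (f x) (λ y → ∑[ x′ ∈ xs ] f x′ y)))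

∑-fibres : ∀ {A B : Set} (R : B → A → Bool) (xs : List A) (ys : List B) (g : A → ℚ) →
           (∀ x → length (filterᵇ (λ y → R y x) ys) ≡ 1) →
           ∑ xs g ≡ ∑[ y ∈ ys ] ∑ (filterᵇ (R y) xs) g
∑-fibres R xs ys g one-fibre = sym (begin
  ∑[ y ∈ ys ] ∑ (filterᵇ (R y) xs) g                    ≡⟨ ∑-cong ys (λ {y} _ → ∑-filterᵇ (R y) xs g) ⟩
  ∑[ y ∈ ys ] ∑[ x ∈ xs ] (if R y x then g x else 0ℚ) ≡⟨ ∑-swap ys xs (λ y x → if R y x then g x else 0ℚ) ⟩
  ∑[ x ∈ xs ] ∑[ y ∈ ys ] (if R y x then g x else 0ℚ) ≡⟨ ∑-cong xs (λ {x} _ → counted-once x) ⟩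
  ∑ xs g                                                ∎)
  where
    open ≡-Reasoning
    counted-once : ∀ x → ∑[ y ∈ ys ] (if R y x then g x else 0ℚ) ≡ g x
    counted-once x = begin
      ∑[ y ∈ ys ] (if R y x then g x else 0ℚ)                   ≡⟨ ∑-filterᵇ (λ y → R y x) ys (λ _ → g x) ⟨
      ∑[ y ∈ filterᵇ (λ y → R y x) ys ] g x                     ≡⟨ ∑-filterᵇ-const _ ys _ (g x) (λ _ _ → refl) ⟩
      fromℤ (+ length (filterᵇ (λ y → R y x) ys)) ℚ.* g x       ≡⟨ cong (λ k → fromℤ (+ k) ℚ.* g x) (one-fibre x) ⟩
      1ℚ ℚ.* g x                                                ≡⟨ ℚP.*-identityˡ (g x) ⟩
      g x                                                       ∎

powerSum-map : ∀ {A : Set} (f : A → ℤ) xs t t>0 → powerSum (map f xs) t t>0 ≡ ∑[ x ∈ xs ] powℤ t t>0 (f x)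
powerSum-map f xs t t>0 = cong sumℚ (sym (map-∘ xs))

powerSumDeriv-map : ∀ {A : Set} (f : A → ℤ) xs t t>0 →
  powerSumDeriv (map f xs) t t>0 ≡ ∑[ x ∈ xs ] (fromℤ (f x) ℚ.* powℤ t t>0 (f x ℤ.- + 1))
powerSumDeriv-map f xs t t>0 = cong sumℚ (sym (map-∘ xs))

+-difference : ∀ m k → + k ≡ + (m ℕ.+ k) ℤ.- + m
+-difference m k = sym (trans (cong (ℤ._- + m) (ℤP.pos-+ m k)) (solve 2 (λ a b → (a :+ b) :- a := b) refl (+ m) (+ k)))
  where open ℤ-Solver.+-*-Solver

-- The hypotheses stand for t^(α+1) t^(z-1) = t^α t^z and its analogue for β.
recurrence-identity : ∀ z q N A B A′ B′ P P′ → A′ ℚ.* P′ ≡ A ℚ.* P → B′ ℚ.* P′ ≡ B ℚ.* P →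
  (z ℚ.+ q) ℚ.* (P ℚ.* A) ℚ.+ (N ℚ.- (z ℚ.+ q)) ℚ.* (P ℚ.* B)
    ≡ (q ℚ.* A ℚ.+ (N ℚ.- q) ℚ.* B) ℚ.* P ℚ.+ (A′ ℚ.- B′) ℚ.* (z ℚ.* P′)
recurrence-identity z q N A B A′ B′ P P′ A′P′≡AP B′P′≡BP = begin
  (z ℚ.+ q) ℚ.* (P ℚ.* A) ℚ.+ (N ℚ.- (z ℚ.+ q)) ℚ.* (P ℚ.* B)
    ≡⟨ solve 6 (λ z q N A B P → (z :+ q) :* (P :* A) :+ (N :+ :- (z :+ q)) :* (P :* B)
                              := (q :* A :+ (N :+ :- q) :* B) :* P :+ (z :* (A :* P) :+ :- (z :* (B :* P))))
               refl z q N A B P ⟩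
  (q ℚ.* A ℚ.+ (N ℚ.- q) ℚ.* B) ℚ.* P ℚ.+ (z ℚ.* (A ℚ.* P) ℚ.- z ℚ.* (B ℚ.* P))
    ≡⟨ cong₂ (λ a b → (q ℚ.* A ℚ.+ (N ℚ.- q) ℚ.* B) ℚ.* P ℚ.+ (z ℚ.* a ℚ.- z ℚ.* b)) A′P′≡AP B′P′≡BP ⟨
  (q ℚ.* A ℚ.+ (N ℚ.- q) ℚ.* B) ℚ.* P ℚ.+ (z ℚ.* (A′ ℚ.* P′) ℚ.- z ℚ.* (B′ ℚ.* P′))
    ≡⟨ solve 5 (λ X z A′ B′ P′ → X :+ (z :* (A′ :* P′) :+ :- (z :* (B′ :* P′))) := X :+ (A′ :+ :- B′) :* (z :* P′))
               refl ((q ℚ.* A ℚ.+ (N ℚ.- q) ℚ.* B) ℚ.* P) z A′ B′ P′ ⟩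
  (q ℚ.* A ℚ.+ (N ℚ.- q) ℚ.* B) ℚ.* P ℚ.+ (A′ ℚ.- B′) ℚ.* (z ℚ.* P′) ∎
  where
    open ≡-Reasoning
    open ℚ-Solver.+-*-Solver

module Recurrence (α β q : ℤ) (Z : (n : ℕ) → NCm n → ℤ) (recursive : RecursiveSecondKind α β q Z)
                  (t : ℚ) (t>0 : 0ℚ ℚ.< t) (n : ℕ) where

  t^_ : ℤ → ℚ
  t^_ = powℤ t t>0

  N : ℕ
  N = suc (suc n) ℕ.+ 1

  X Y : ℚ
  X = fromℤ q ℚ.* t^ α ℚ.+ fromℤ (+ N ℤ.- q) ℚ.* t^ β
  Y = t^ (α ℤ.+ + 1) ℚ.- t^ (β ℤ.+ + 1)

  children-sum : ∀ ρ → ∑[ π ∈ filterᵇ (inC ρ) (enumNCm (suc (suc n))) ] t^ Z _ π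
                       ≡ fromℤ (Z _ ρ ℤ.+ q) ℚ.* t^ (Z _ ρ ℤ.+ α) ℚ.+ fromℤ (+ N ℤ.- (Z _ ρ ℤ.+ q)) ℚ.* t^ (Z _ ρ ℤ.+ β)
  children-sum ρ = begin
    ∑ (filterᵇ (inC ρ) E) g
      ≡⟨ ∑-filterᵇ-split (inC ρ) Co E g ⟩
    ∑ (filterᵇ (λ π → inC ρ π ∧ Co π) E) g ℚ.+ ∑ (filterᵇ (λ π → inC ρ π ∧ not (Co π)) E) g
      ≡⟨ cong₂ ℚ._+_ (∑-filterᵇ-const _ E g (t^ (z ℤ.+ α)) (λ π → cong t^_ ∘ on-Co π))
                      (∑-filterᵇ-const _ E g (t^ (z ℤ.+ β)) (λ π → cong t^_ ∘ off-Co π)) ⟩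
    fromℤ (+ c₁) ℚ.* t^ (z ℤ.+ α) ℚ.+ fromℤ (+ c₂) ℚ.* t^ (z ℤ.+ β)
      ≡⟨ cong₂ (λ a b → fromℤ a ℚ.* t^ (z ℤ.+ α) ℚ.+ fromℤ b ℚ.* t^ (z ℤ.+ β)) |Co| c₂≡ ⟩
    fromℤ (z ℤ.+ q) ℚ.* t^ (z ℤ.+ α) ℚ.+ fromℤ (+ N ℤ.- (z ℤ.+ q)) ℚ.* t^ (z ℤ.+ β) ∎
    where
      open ≡-Reasoning
      E = enumNCm (suc (suc n))
      g = λ π → t^ Z _ π
      z = Z _ ρ
      Co = proj₁ (recursive n ρ)
      on-Co : ∀ π → T (inC ρ π ∧ Co π) → Z _ π ≡ z ℤ.+ α
      on-Co π h = let (child , in-Co) = to (T-∧ {inC ρ π}) h in proj₁ (proj₂ (recursive n ρ)) π child in-Co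
      off-Co : ∀ π → T (inC ρ π ∧ not (Co π)) → Z _ π ≡ z ℤ.+ β
      off-Co π h = let (child , off) = to (T-∧ {inC ρ π}) h in proj₁ (proj₂ (proj₂ (recursive n ρ))) π child off
      c₁ = length (filterᵇ (λ π → inC ρ π ∧ Co π) E)
      c₂ = length (filterᵇ (λ π → inC ρ π ∧ not (Co π)) E)
      |Co| : + c₁ ≡ z ℤ.+ q
      |Co| = proj₂ (proj₂ (proj₂ (recursive n ρ)))
      c₁+c₂≡N : c₁ ℕ.+ c₂ ≡ N
      c₁+c₂≡N = trans (sym (length-filterᵇ-split (inC ρ) Co E))
                      (trans (number-of-children ρ) (cong (suc ∘ suc) (+-comm 1 n)))
      c₂≡ : + c₂ ≡ + N ℤ.- (z ℤ.+ q)
      c₂≡ = trans (+-difference c₁ c₂) (cong₂ ℤ._-_ (cong +_ c₁+c₂≡N) |Co|)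

  -- The part of the counts proportional to z becomes the derivative term:
  -- z t^(z+α) = t^(α+1) · z t^(z-1).
  children-sum-rearranged : ∀ z →
    fromℤ (z ℤ.+ q) ℚ.* t^ (z ℤ.+ α) ℚ.+ fromℤ (+ N ℤ.- (z ℤ.+ q)) ℚ.* t^ (z ℤ.+ β)
      ≡ X ℚ.* t^ z ℚ.+ Y ℚ.* (fromℤ z ℚ.* t^ (z ℤ.- + 1))
  children-sum-rearranged z = begin
    fromℤ (z ℤ.+ q) ℚ.* t^ (z ℤ.+ α) ℚ.+ fromℤ (+ N ℤ.- (z ℤ.+ q)) ℚ.* t^ (z ℤ.+ β)
      ≡⟨ cong₂ (λ a b → a ℚ.* t^ (z ℤ.+ α) ℚ.+ b ℚ.* t^ (z ℤ.+ β)) (fromℤ-+ z q)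
               (trans (fromℤ-minus (+ N) (z ℤ.+ q)) (cong (λ a → fN ℚ.- a) (fromℤ-+ z q))) ⟩
    (fz ℚ.+ fq) ℚ.* t^ (z ℤ.+ α) ℚ.+ (fN ℚ.- (fz ℚ.+ fq)) ℚ.* t^ (z ℤ.+ β)
      ≡⟨ cong₂ (λ a b → (fz ℚ.+ fq) ℚ.* a ℚ.+ (fN ℚ.- (fz ℚ.+ fq)) ℚ.* b) (powℤ-+ t t>0 z α) (powℤ-+ t t>0 z β) ⟩
    (fz ℚ.+ fq) ℚ.* (t^ z ℚ.* t^ α) ℚ.+ (fN ℚ.- (fz ℚ.+ fq)) ℚ.* (t^ z ℚ.* t^ β)
      ≡⟨ recurrence-identity fz fq fN (t^ α) (t^ β) (t^ (α ℤ.+ + 1)) (t^ (β ℤ.+ + 1)) (t^ z) (t^ (z ℤ.- + 1))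
                             (powℤ-shift t t>0 α z) (powℤ-shift t t>0 β z) ⟩
    (fq ℚ.* t^ α ℚ.+ (fN ℚ.- fq) ℚ.* t^ β) ℚ.* t^ z ℚ.+ Y ℚ.* (fz ℚ.* t^ (z ℤ.- + 1))
      ≡⟨ cong (λ a → (fq ℚ.* t^ α ℚ.+ a ℚ.* t^ β) ℚ.* t^ z ℚ.+ Y ℚ.* (fz ℚ.* t^ (z ℤ.- + 1))) (fromℤ-minus (+ N) q) ⟨
    X ℚ.* t^ z ℚ.+ Y ℚ.* (fz ℚ.* t^ (z ℤ.- + 1)) ∎
    where
      open ≡-Reasoning
      fz = fromℤ z
      fq = fromℤ q
      fN = fromℤ (+ N)

theorem6p1 : (α β q : ℤ) (Z : (n : ℕ) → NCm n → ℤ) →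
    RecursiveSecondKind α β q Z →
    (n : ℕ) (t : ℚ) (t>0 : 0ℚ ℚ.< t) →
    L Z (suc (suc n)) t t>0
      ≡ ((fromℤ q ℚ.* powℤ t t>0 α
           ℚ.+ fromℤ (+ (suc (suc n) ℕ.+ 1) ℤ.- q) ℚ.* powℤ t t>0 β)
          ℚ.* L Z (suc n) t t>0)
        ℚ.+ ((powℤ t t>0 (α ℤ.+ + 1) ℚ.- powℤ t t>0 (β ℤ.+ + 1))
          ℚ.* L′ Z (suc n) t t>0)
theorem6p1 α β q Z recursive n t t>0 = begin
  L Z (suc (suc n)) t t>0
    ≡⟨ powerSum-map (Z _) E₂ t t>0 ⟩
  ∑[ π ∈ E₂ ] t^ Z _ π
    ≡⟨ ∑-fibres inC E₂ E₁ (λ π → t^ Z _ π) parent-unique ⟩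
  ∑[ ρ ∈ E₁ ] ∑[ π ∈ filterᵇ (inC ρ) E₂ ] t^ Z _ π
    ≡⟨ ∑-cong E₁ (λ {ρ} _ → trans (children-sum ρ) (children-sum-rearranged (Z _ ρ))) ⟩
  ∑[ ρ ∈ E₁ ] (X ℚ.* t^ Z _ ρ ℚ.+ Y ℚ.* (fromℤ (Z _ ρ) ℚ.* t^ (Z _ ρ ℤ.- + 1)))
    ≡⟨ ∑-linear E₁ X Y _ _ ⟩
  X ℚ.* ∑[ ρ ∈ E₁ ] t^ Z _ ρ ℚ.+ Y ℚ.* ∑[ ρ ∈ E₁ ] (fromℤ (Z _ ρ) ℚ.* t^ (Z _ ρ ℤ.- + 1))
    ≡⟨ cong₂ (λ a b → X ℚ.* a ℚ.+ Y ℚ.* b) (powerSum-map (Z _) E₁ t t>0) (powerSumDeriv-map (Z _) E₁ t t>0) ⟨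
  X ℚ.* L Z (suc n) t t>0 ℚ.+ Y ℚ.* L′ Z (suc n) t t>0 ∎
  where
    open Recurrence α β q Z recursive t t>0 n
    open ≡-Reasoning
    E₁ : List (NCm (suc n))
    E₁ = enumNCm (suc n)
    E₂ : List (NCm (suc (suc n)))
    E₂ = enumNCm (suc (suc n))
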